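{- For every integer $n\ge 1$, $\mathrm{a}_{001,210}(n)=\binom{n}{3}+n$.
   Context: An ascent of an integer word $x_1\cdots x_n$ is an index $j$ with $x_j<x_{j+1}$; $\mathrm{asc}(x_1\cdots x_n)$ denotes the number of ascents. An ascent sequence of length $n$ is a sequence $x_1\cdots x_n$ of nonnegative integers with $x_1=0$ and $x_i\le \mathrm{asc}(x_1\cdots x_{i-1})+1$ for all $1<i\le n$. A pattern is a word $p=p_1\cdots p_k$ of nonnegative integers whose set of values is $\{0,1,\dots,m\}$ for some $m$. A word $x_1\cdots x_n$ contains $p$ if there are indices $i_1<\cdots<i_k$ such that $x_{i_1}\cdots x_{i_k}$ is order-isomorphic to $p$ (i.e. for all $s,t$, $x_{i_s}<x_{i_t}$ iff $p_s<p_t$ and $x_{i_s}=x_{i_t}$ iff $p_s=p_t$); otherwise it avoids $p$. For a list $B$ of patterns, $\mathcal{A}_B(n)$ is the set of ascent sequences of length $n$ avoiding every pattern in $B$, and $\mathrm{a}_B(n)=|\mathcal{A}_B(n)|$. -}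

module Defs where

open import Data.Nat using (ℕ; zero; suc; _+_; _≤_; _<_; _<ᵇ_)
open import Data.Bool using (if_then_else_)
open import Data.List using (List; []; _∷_; length; lookup; take)
open import Data.List.Relation.Binary.Sublist.Propositional using (_⊆_)
open import Data.List.Relation.Unary.All using (All)
open import Data.Fin using (Fin; toℕ; cast)
open import Data.Product using (Σ; _×_; ∃)
open import Function.Bundles using (_⇔_)
open import Relation.Binary.PropositionalEquality using (_≡_)
open import Relation.Nullary using (¬_)

asc : List ℕ → ℕ
asc []           = 0
asc (x ∷ [])     = 0
asc (x ∷ y ∷ r)  = (if x <ᵇ y then 1 else 0) + asc (y ∷ r)

-- x is an ascent sequence: x_1 = 0 and, for every position i > 1 (0-based
-- index k = i-1 ≥ 1), x_i ≤ asc(x_1 ⋯ x_{i-1}) + 1.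
IsAscentSeq : List ℕ → Set
IsAscentSeq x =
  (∀ (k : Fin (length x)) → toℕ k ≡ 0 → lookup x k ≡ 0) ×
  (∀ (k : Fin (length x)) → 0 < toℕ k → lookup x k ≤ suc (asc (take (toℕ k) x)))

OrderIso : List ℕ → List ℕ → Set
OrderIso u p = Σ (length u ≡ length p) λ eq →
  ∀ (s t : Fin (length u)) →
    ((lookup u s < lookup u t) ⇔ (lookup p (cast eq s) < lookup p (cast eq t))) ×
    ((lookup u s ≡ lookup u t) ⇔ (lookup p (cast eq s) ≡ lookup p (cast eq t)))

Contains : List ℕ → List ℕ → Set
Contains x p = ∃ λ u → (u ⊆ x) × OrderIso u p

Avoids : List ℕ → List ℕ → Set
Avoids x p = ¬ Contains x p

InA : List (List ℕ) → ℕ → List ℕ → Set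
InA B n x = IsAscentSeq x × (length x ≡ n) × All (Avoids x) B

-- a_B(n) = c : the set 𝒜_B(n) is enumerated, without repetition, by a list of
-- length c
HasCount : List (List ℕ) → ℕ → ℕ → Set
HasCount B n c = Σ (List (List ℕ)) λ L →
  Unique L × (length L ≡ c) × (∀ x → (x ∈ L) ⇔ InA B n x)
  where
  open import Data.List.Relation.Unary.Unique.Propositional using (Unique)
  open import Data.List.Membership.Propositional using (_∈_)

-- An ascent sequence avoiding 001 and 210 is a staircase 0 1 ⋯ m, followed by
-- further copies of its top m, followed by copies of a single value b < m.
-- Indeed, after the staircase every value ≤ m has already occurred, so 001
-- forbids any later rise from such a value, and the ascent condition forbids
-- jumping past m + 1 while still on the staircase; once the word leaves the
-- staircase, 210 forbids falling a second time.  Counting by m and by the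
-- position and value of the fall gives ∑ₘ (1 + m (n - 1 - m)) = n + C(n,3).
module Submission where

open import Defs
open import Data.Bool using (if_then_else_)
open import Data.Bool.Properties using (T-≡)
open import Data.Fin using (Fin; toℕ; cast; zero; suc)
open import Data.List using (List; []; _∷_; [_]; length; lookup; take; map; _++_; upTo; replicate)
open import Data.List.Properties using (length-map; length-++; length-replicate; length-upTo; ∷-injectiveˡ; ∷-injectiveʳ)
open import Data.List.Membership.Propositional using (_∈_; _∉_)
open import Data.List.Membership.Propositional.Properties
  using (∈-map⁺; ∈-map⁻; ∈-++⁺ˡ; ∈-++⁺ʳ; ∈-++⁻; ∈-upTo⁺; ∈-upTo⁻)
open import Data.List.Relation.Binary.Disjoint.Propositional using (Disjoint)
open import Data.List.Relation.Binary.Sublist.Propositional using (_⊆_; []; _∷_; _∷ʳ_; ⊆-trans; to∈; from∈)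
open import Data.List.Relation.Binary.Sublist.Propositional.Properties using (All-resp-⊆)
open import Data.List.Relation.Unary.All as All using (All; []; _∷_)
open import Data.List.Relation.Unary.All.Properties using (replicate⁺)
open import Data.List.Relation.Unary.Any using (here)
open import Data.List.Relation.Unary.AllPairs using ([]; _∷_)
open import Data.List.Relation.Unary.Unique.Propositional using (Unique)
import Data.List.Relation.Unary.Unique.Propositional.Properties as Unique
open import Data.Nat using (ℕ; zero; suc; _+_; _*_; _≤_; _<_; _<ᵇ_; _≤?_; z≤n; s≤s; z<s)
open import Data.Nat.Combinatorics using (_C_; nCk+nC[k+1]≡[n+1]C[k+1]; nC1≡n)
open import Data.Nat.Properties
open import Data.Nat.Tactic.RingSolver using (solve-∀)
open import Data.Product using (∃; _×_; _,_; proj₁; proj₂)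
open import Data.Sum using (_⊎_; inj₁; inj₂)
open import Data.Unit using (⊤; tt)
open import Function.Bundles using (_⇔_; mk⇔; Equivalence)
open import Relation.Binary.Definitions using (tri<; tri≈; tri>)
open import Relation.Binary.PropositionalEquality hiding ([_])
open import Relation.Nullary using (¬_; yes; no; contradiction)

open Equivalence using (to; from)

-- Order isomorphism along strictly increasing maps

StrictlyIncreasing : (ℕ → ℕ) → Set
StrictlyIncreasing f = ∀ {x y} → x < y → f x < f y

module _ {f : ℕ → ℕ} (f-increasing : StrictlyIncreasing f) where

  increasing-reflects-< : ∀ {x y} → f x < f y → x < y
  increasing-reflects-< {x} {y} fx<fy with <-cmp x y
  ... | tri< x<y _ _ = x<y
  ... | tri≈ _ refl _ = contradiction fx<fy (<-irrefl refl)
  ... | tri> _ _ y<x = contradiction fx<fy (<-asym (f-increasing y<x))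

  increasing-injective : ∀ {x y} → f x ≡ f y → x ≡ y
  increasing-injective {x} {y} fx≡fy with <-cmp x y
  ... | tri< x<y _ _ = contradiction fx≡fy (<⇒≢ (f-increasing x<y))
  ... | tri≈ _ x≡y _ = x≡y
  ... | tri> _ _ y<x = contradiction fx≡fy (>⇒≢ (f-increasing y<x))

lookup-map : ∀ {A B : Set} (f : A → B) xs (i : Fin (length (map f xs))) →
             lookup (map f xs) i ≡ f (lookup xs (cast (length-map f xs) i))
lookup-map f (x ∷ xs) zero    = refl
lookup-map f (x ∷ xs) (suc i) = lookup-map f xs i

orderIso-map : ∀ {f} → StrictlyIncreasing f → ∀ p → OrderIso (map f p) p
orderIso-map {f} f-increasing p = length-map f p , λ s t →
  let x = lookup p (cast (length-map f p) s)
      y = lookup p (cast (length-map f p) t)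
  in subst₂ (λ u v → ((u < v) ⇔ (x < y)) × ((u ≡ v) ⇔ (x ≡ y)))
       (sym (lookup-map f p s)) (sym (lookup-map f p t))
       (mk⇔ (increasing-reflects-< f-increasing) f-increasing ,
        mk⇔ (increasing-injective f-increasing) (cong f))

prepend : ℕ → (ℕ → ℕ) → ℕ → ℕ
prepend a g zero    = a
prepend a g (suc n) = g n

prepend-increasing : ∀ {a g} → a < g 0 → StrictlyIncreasing g → StrictlyIncreasing (prepend a g)
prepend-increasing a<g0 g-increasing {zero}  {suc zero}    _         = a<g0
prepend-increasing a<g0 g-increasing {zero}  {suc (suc y)} _         = <-trans a<g0 (g-increasing z<s)
prepend-increasing a<g0 g-increasing {suc x} {suc y}       (s≤s x<y) = g-increasing x<y

p001 p210 : List ℕ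
p001 = 0 ∷ 0 ∷ 1 ∷ []
p210 = 2 ∷ 1 ∷ 0 ∷ []

No001 No210 : List ℕ → Set
No001 w = ∀ {a c} → (a ∷ a ∷ c ∷ []) ⊆ w → ¬ a < c
No210 w = ∀ {a b c} → (a ∷ b ∷ c ∷ []) ⊆ w → b < a → ¬ c < b

avoids001⇔ : ∀ {w} → Avoids w p001 ⇔ No001 w
avoids001⇔ = mk⇔ (λ avoids {a} {c} occ a<c → avoids (_ , occ , orderIso-map (increasing a<c) p001)) no001⇒avoids
  where
  increasing : ∀ {a c} → a < c → StrictlyIncreasing (prepend a (_+ c))
  increasing {c = c} a<c = prepend-increasing a<c (+-monoˡ-< c)

  no001⇒avoids : ∀ {w} → No001 w → Avoids w p001
  no001⇒avoids no001 ([]                    , _ , () , _)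
  no001⇒avoids no001 (_ ∷ []                , _ , () , _)
  no001⇒avoids no001 (_ ∷ _ ∷ []            , _ , () , _)
  no001⇒avoids no001 (_ ∷ _ ∷ _ ∷ _ ∷ _     , _ , () , _)
  no001⇒avoids no001 (a ∷ b ∷ c ∷ [] , occ , _ , iso) with from (proj₂ (iso zero (suc zero))) refl
  ... | refl = no001 occ (from (proj₁ (iso (suc zero) (suc (suc zero)))) z<s)

avoids210⇔ : ∀ {w} → Avoids w p210 ⇔ No210 w
avoids210⇔ = mk⇔ (λ avoids {a} {b} {c} occ b<a c<b → avoids (_ , occ , orderIso-map (increasing b<a c<b) p210))
                 no210⇒avoids
  where
  increasing : ∀ {a b c} → b < a → c < b → StrictlyIncreasing (prepend c (prepend b (_+ a)))
  increasing {a} b<a c<b = prepend-increasing c<b (prepend-increasing b<a (+-monoˡ-< a))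

  no210⇒avoids : ∀ {w} → No210 w → Avoids w p210
  no210⇒avoids no210 ([]                , _ , () , _)
  no210⇒avoids no210 (_ ∷ []            , _ , () , _)
  no210⇒avoids no210 (_ ∷ _ ∷ []        , _ , () , _)
  no210⇒avoids no210 (_ ∷ _ ∷ _ ∷ _ ∷ _ , _ , () , _)
  no210⇒avoids no210 (a ∷ b ∷ c ∷ [] , occ , _ , iso) =
    no210 occ (from (proj₁ (iso (suc zero) zero)) (s≤s z<s))
              (from (proj₁ (iso (suc (suc zero)) (suc zero))) z<s)

-- Ascent sequences, read letter by letter

ascent : ℕ → ℕ → ℕ
ascent l v = if l <ᵇ v then 1 else 0

-- ys can follow a prefix of an ascent sequence with c ascents and last letter l.
AscentFrom : ℕ → ℕ → List ℕ → Set
AscentFrom c l []       = ⊤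
AscentFrom c l (v ∷ ys) = v ≤ suc c × AscentFrom (c + ascent l v) v ys

ascent-< : ∀ {l v} → l < v → ascent l v ≡ 1
ascent-< l<v rewrite to T-≡ (<⇒<ᵇ l<v) = refl

+-ascent-suc : ∀ m → m + ascent m (suc m) ≡ suc m
+-ascent-suc m rewrite ascent-< (n<1+n m) = +-comm m 1

ascentFrom⇔ : ∀ c l ys →
  AscentFrom c l ys ⇔ (∀ k → lookup ys k ≤ suc (c + asc (l ∷ take (toℕ k) ys)))
ascentFrom⇔ c l ys = mk⇔ (bounded c l ys) (ascentFrom c l ys)
  where
  bounded : ∀ c l ys → AscentFrom c l ys → ∀ k → lookup ys k ≤ suc (c + asc (l ∷ take (toℕ k) ys))
  bounded c l (v ∷ ys) (v≤ , rest) zero    = subst (λ d → v ≤ suc d) (sym (+-identityʳ c)) v≤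
  bounded c l (v ∷ ys) (v≤ , rest) (suc k) =
    subst (λ d → lookup ys k ≤ suc d) (+-assoc c (ascent l v) _) (bounded _ v ys rest k)

  ascentFrom : ∀ c l ys → (∀ k → lookup ys k ≤ suc (c + asc (l ∷ take (toℕ k) ys))) → AscentFrom c l ys
  ascentFrom c l []       bound = tt
  ascentFrom c l (v ∷ ys) bound =
    subst (λ d → v ≤ suc d) (+-identityʳ c) (bound zero) ,
    ascentFrom _ v ys (λ k → subst (λ d → lookup ys k ≤ suc d) (sym (+-assoc c (ascent l v) _)) (bound (suc k)))

isAscentSeq⇔ : ∀ {x xs} → IsAscentSeq (x ∷ xs) ⇔ (x ≡ 0 × AscentFrom 0 x xs)
isAscentSeq⇔ {x} {xs} = mk⇔
  (λ (starts , bound) → starts zero refl , from (ascentFrom⇔ 0 x xs) (λ k → bound (suc k) z<s))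
  (λ { (refl , rest) → starts , bound rest })
  where
  starts : ∀ k → toℕ k ≡ 0 → lookup (0 ∷ xs) k ≡ 0
  starts zero _ = refl

  bound : AscentFrom 0 0 xs → ∀ k → 0 < toℕ k → lookup (0 ∷ xs) k ≤ suc (asc (take (toℕ k) (0 ∷ xs)))
  bound rest (suc k) _ = to (ascentFrom⇔ 0 0 xs) rest k

ascentFrom-bounded : ∀ c l {ys} → All (_≤ suc c) ys → AscentFrom c l ys
ascentFrom-bounded c l []               = tt
ascentFrom-bounded c l {v ∷ _} (v≤ ∷ vs) =
  v≤ , ascentFrom-bounded _ v (All.map (λ u≤ → ≤-trans u≤ (s≤s (m≤m+n c _))) vs)

-- The shape of the avoiders

-- Climbing m ys: the word 0 1 ⋯ m ys has the shape of an avoider, i.e. ys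
-- climbs by steps of one to some top t ≥ m and is then Settled t:
-- of the form t ⋯ t b ⋯ b with b < t.
data Settled (m : ℕ) : List ℕ → Set where
  []   : Settled m []
  stay : ∀ {ys} → Settled m ys → Settled m (m ∷ ys)
  drop : ∀ {b ys} → b < m → All (_≡ b) ys → Settled m (b ∷ ys)

data Climbing (m : ℕ) : List ℕ → Set where
  climb  : ∀ {ys} → Climbing (suc m) ys → Climbing m (suc m ∷ ys)
  settle : ∀ {ys} → Settled m ys → Climbing m ys

settled-bounded : ∀ {m ys} → Settled m ys → All (_≤ m) ys
settled-bounded []              = []
settled-bounded (stay s)        = ≤-refl ∷ settled-bounded s
settled-bounded (drop b<m flat) = <⇒≤ b<m ∷ All.map (λ { refl → <⇒≤ b<m }) flat

DropsFrom ChangesAbove : ℕ → List ℕ → Set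
DropsFrom    m w = ∀ {b c} → (b ∷ c ∷ []) ⊆ w → b ≡ c ⊎ (b ≡ m × c < b)
ChangesAbove m w = ∀ {b c} → (b ∷ c ∷ []) ⊆ w → b ≢ c → m ≤ b

settled-dropsFrom : ∀ {m ys} → Settled m ys → DropsFrom m (m ∷ ys)
settled-dropsFrom s (refl ∷ occ) with m≤n⇒m<n∨m≡n (All.lookup (settled-bounded s) (to∈ occ))
... | inj₁ c<m = inj₂ (refl , c<m)
... | inj₂ c≡m = inj₁ (sym c≡m)
settled-dropsFrom []            (_ ∷ʳ ())
settled-dropsFrom (stay s)      (_ ∷ʳ occ) = settled-dropsFrom s occ
settled-dropsFrom (drop _ flat) (_ ∷ʳ occ) with All-resp-⊆ occ (refl ∷ flat)
... | refl ∷ refl ∷ [] = inj₁ refl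

pair₁₂ : ∀ {a b c : ℕ} → (a ∷ b ∷ []) ⊆ (a ∷ b ∷ c ∷ [])
pair₁₂ = refl ∷ refl ∷ _ ∷ʳ []

pair₁₃ : ∀ {a b c : ℕ} → (a ∷ c ∷ []) ⊆ (a ∷ b ∷ c ∷ [])
pair₁₃ = refl ∷ _ ∷ʳ refl ∷ []

pair₂₃ : ∀ {a b c : ℕ} → (b ∷ c ∷ []) ⊆ (a ∷ b ∷ c ∷ [])
pair₂₃ = _ ∷ʳ refl ∷ refl ∷ []

module _ {m w} (drops : DropsFrom m w) where

  dropsFrom⇒no001 : No001 w
  dropsFrom⇒no001 occ a<c with drops (⊆-trans pair₁₃ occ)
  ... | inj₁ refl      = <-irrefl refl a<c
  ... | inj₂ (_ , c<a) = <-asym a<c c<a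

  dropsFrom⇒no210 : No210 w
  dropsFrom⇒no210 occ b<a c<b with drops (⊆-trans pair₁₂ occ) | drops (⊆-trans pair₂₃ occ)
  ... | inj₁ refl       | _               = <-irrefl refl b<a
  ... | _               | inj₁ refl       = <-irrefl refl c<b
  ... | inj₂ (refl , _) | inj₂ (refl , _) = <-irrefl refl b<a

  dropsFrom⇒changesAbove : ChangesAbove m w
  dropsFrom⇒changesAbove occ b≢c with drops occ
  ... | inj₁ b≡c        = contradiction b≡c b≢c
  ... | inj₂ (refl , _) = ≤-refl

climbing-avoids : ∀ {m ys} → Climbing m ys → No001 (m ∷ ys) × No210 (m ∷ ys) × ChangesAbove m (m ∷ ys)
climbing-avoids (settle s) =
  dropsFrom⇒no001 drops , dropsFrom⇒no210 drops , dropsFrom⇒changesAbove drops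
  where drops = settled-dropsFrom s
climbing-avoids {m} {_ ∷ ys} (climb c) = no001 , no210 , changesAbove
  where
  higher = climbing-avoids c

  changesAbove↑ : ChangesAbove (suc m) (suc m ∷ ys)
  changesAbove↑ = proj₂ (proj₂ higher)

  no001 : No001 (m ∷ suc m ∷ ys)
  no001 (_ ∷ʳ occ)   = proj₁ higher occ
  no001 (refl ∷ occ) m<c = 1+n≰n (changesAbove↑ occ (<⇒≢ m<c))

  no210 : No210 (m ∷ suc m ∷ ys)
  no210 (_ ∷ʳ occ)   = proj₁ (proj₂ higher) occ
  no210 (refl ∷ occ) b<m c<b = <-asym b<m (changesAbove↑ occ (>⇒≢ c<b))

  changesAbove : ChangesAbove m (m ∷ suc m ∷ ys)
  changesAbove (_ ∷ʳ occ)   b≢c = <⇒≤ (changesAbove↑ occ b≢c)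
  changesAbove (refl ∷ occ) _   = ≤-refl

climbing⇒ascentFrom : ∀ {m ys} → Climbing m ys → AscentFrom m m ys
climbing⇒ascentFrom {m} {_ ∷ ys} (climb c) =
  ≤-refl , subst (λ d → AscentFrom d (suc m) ys) (sym (+-ascent-suc m)) (climbing⇒ascentFrom c)
climbing⇒ascentFrom {m} (settle s) = ascentFrom-bounded m m (All.map m≤n⇒m≤1+n (settled-bounded s))

-- The constraints that 0 1 ⋯ m ys avoiding 001, resp. 210, puts on ys beyond
-- ys itself avoiding it: every b ≤ m, and m itself, occur before ys.
No001After No210After : ℕ → List ℕ → Set
No001After m ys = ∀ {b c} → (b ∷ c ∷ []) ⊆ ys → b ≤ m → ¬ b < c
No210After m ys = ∀ {b c} → (b ∷ c ∷ []) ⊆ ys → b < m → ¬ c < b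

settled-of : ∀ {m ys} → All (_≤ m) ys → No001After m ys → No210After m ys → Settled m ys
settled-of [] _ _ = []
settled-of {m} {v ∷ ys} (v≤m ∷ bounded) no001 no210 with m≤n⇒m<n∨m≡n v≤m
... | inj₂ refl = stay (settled-of bounded (λ occ → no001 (v ∷ʳ occ)) (λ occ → no210 (v ∷ʳ occ)))
... | inj₁ v<m  = drop v<m (All.tabulate constant)
  where
  constant : ∀ {c} → c ∈ ys → c ≡ v
  constant {c} c∈ys with <-cmp c v
  ... | tri< c<v _ _ = contradiction c<v (no210 (refl ∷ from∈ c∈ys) v<m)
  ... | tri≈ _ c≡v _ = c≡v
  ... | tri> _ _ v<c = contradiction v<c (no001 (refl ∷ from∈ c∈ys) (<⇒≤ v<m))

climbing-of : ∀ {m ys} → AscentFrom m m ys → No001 ys → No210 ys →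
              No001After m ys → No210After m ys → Climbing m ys
climbing-of {ys = []} _ _ _ _ _ = settle []
climbing-of {m} {v ∷ ys} (v≤1+m , rest) no001 no210 after001 after210 with v ≤? m
... | yes v≤m = settle (settled-of (v≤m ∷ All.tabulate below) after001 after210)
  where
  below : ∀ {c} → c ∈ ys → c ≤ m
  below c∈ys = ≤-trans (≮⇒≥ (after001 (refl ∷ from∈ c∈ys) v≤m)) v≤m
... | no v≰m with ≤-antisym v≤1+m (≰⇒> v≰m)
... | refl = climb (climbing-of (subst (λ d → AscentFrom d v ys) (+-ascent-suc m) rest)
                      (λ occ → no001 (v ∷ʳ occ)) (λ occ → no210 (v ∷ʳ occ)) after001′ after210′)
  where
  after001′ : No001After (suc m) ys
  after001′ occ b≤1+m with m≤n⇒m<n∨m≡n b≤1+m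
  ... | inj₁ b<1+m = after001 (v ∷ʳ occ) (≤-pred b<1+m)
  ... | inj₂ refl  = no001 (refl ∷ occ)

  after210′ : No210After (suc m) ys
  after210′ occ b<1+m with m≤n⇒m<n∨m≡n (≤-pred b<1+m)
  ... | inj₁ b<m  = after210 (v ∷ʳ occ) b<m
  ... | inj₂ refl = no210 (refl ∷ occ) (n<1+n m)

flats : ℕ → ℕ → List (List ℕ)
flats n m = map (λ b → b ∷ replicate n b) (upTo m)

settleds : ℕ → ℕ → List (List ℕ)
settleds m zero    = [ [] ]
settleds m (suc n) = map (m ∷_) (settleds m n) ++ flats n m

climbings : ℕ → ℕ → List (List ℕ)
climbings m zero    = [ [] ]
climbings m (suc n) = map (suc m ∷_) (climbings (suc m) n) ++ settleds m (suc n)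

all≡⇒replicate : ∀ {b} {ys : List ℕ} → All (_≡ b) ys → ys ≡ replicate (length ys) b
all≡⇒replicate []            = refl
all≡⇒replicate (refl ∷ flat) = cong (_ ∷_) (all≡⇒replicate flat)

∈-flats⁻ : ∀ {n m xs} → xs ∈ flats n m → ∃ λ b → b < m × xs ≡ b ∷ replicate n b
∈-flats⁻ xs∈ with ∈-map⁻ _ xs∈
... | b , b∈ , refl = b , ∈-upTo⁻ b∈ , refl

∈-flats⁺ : ∀ {m b ys} → b < m → All (_≡ b) ys → b ∷ ys ∈ flats (length ys) m
∈-flats⁺ {m} {b} {ys} b<m flat =
  subst (λ zs → b ∷ zs ∈ flats (length ys) m) (sym (all≡⇒replicate flat))
    (∈-map⁺ (λ b → b ∷ replicate (length ys) b) (∈-upTo⁺ b<m))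

∈-settleds⇔ : ∀ {m n ys} → ys ∈ settleds m n ⇔ (Settled m ys × length ys ≡ n)
∈-settleds⇔ {m} = mk⇔ (settled _) (λ { (s , refl) → enumerated s })
  where
  settled : ∀ n {ys} → ys ∈ settleds m n → Settled m ys × length ys ≡ n
  settled zero (here refl) = [] , refl
  settled (suc n) ys∈ with ∈-++⁻ (map (m ∷_) (settleds m n)) ys∈
  ... | inj₁ ys∈stays with ∈-map⁻ (m ∷_) ys∈stays
  ...   | zs , zs∈ , refl = let s , len = settled n zs∈ in stay s , cong suc len
  settled (suc n) ys∈ | inj₂ ys∈flats with ∈-flats⁻ ys∈flats
  ...   | b , b<m , refl = drop b<m (replicate⁺ n refl) , cong suc (length-replicate n)

  enumerated : ∀ {ys} → Settled m ys → ys ∈ settleds m (length ys)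
  enumerated []                        = here refl
  enumerated (stay s)                  = ∈-++⁺ˡ (∈-map⁺ (m ∷_) (enumerated s))
  enumerated (drop {ys = ys} b<m flat) = ∈-++⁺ʳ (map (m ∷_) (settleds m (length ys))) (∈-flats⁺ b<m flat)

∈-climbings⇔ : ∀ {m n ys} → ys ∈ climbings m n ⇔ (Climbing m ys × length ys ≡ n)
∈-climbings⇔ = mk⇔ (climbing _) (λ { (c , refl) → enumerated c })
  where
  climbing : ∀ {m} n {ys} → ys ∈ climbings m n → Climbing m ys × length ys ≡ n
  climbing zero (here refl) = settle [] , refl
  climbing {m} (suc n) ys∈ with ∈-++⁻ (map (suc m ∷_) (climbings (suc m) n)) ys∈
  ... | inj₁ ys∈climbs with ∈-map⁻ (suc m ∷_) ys∈climbs
  ...   | zs , zs∈ , refl = let c , len = climbing n zs∈ in climb c , cong suc len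
  climbing (suc n) ys∈ | inj₂ ys∈settles =
    let s , len = to ∈-settleds⇔ ys∈settles in settle s , len

  enumerated : ∀ {m ys} → Climbing m ys → ys ∈ climbings m (length ys)
  enumerated {m} (climb c)           = ∈-++⁺ˡ (∈-map⁺ (suc m ∷_) (enumerated c))
  enumerated {ys = []} (settle s)    = here refl
  enumerated {m} {_ ∷ ys} (settle s) =
    ∈-++⁺ʳ (map (suc m ∷_) (climbings (suc m) (length ys))) (from ∈-settleds⇔ (s , refl))

map-∷-disjoint : ∀ {h : ℕ} {L M : List (List ℕ)} → (∀ {ys} → h ∷ ys ∉ M) → Disjoint (map (h ∷_) L) M
map-∷-disjoint h∷∉M (x∈L , x∈M) with ∈-map⁻ _ x∈L
... | _ , _ , refl = h∷∉M x∈M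

settleds-unique : ∀ m n → Unique (settleds m n)
settleds-unique m zero    = [] ∷ []
settleds-unique m (suc n) =
  Unique.++⁺ (Unique.map⁺ ∷-injectiveʳ (settleds-unique m n))
             (Unique.map⁺ ∷-injectiveˡ (Unique.upTo⁺ m))
             (map-∷-disjoint λ m∷ys∈ → let _ , b<m , eq = ∈-flats⁻ m∷ys∈ in
                                       <-irrefl (sym (∷-injectiveˡ eq)) b<m)

climbings-unique : ∀ m n → Unique (climbings m n)
climbings-unique m zero    = [] ∷ []
climbings-unique m (suc n) =
  Unique.++⁺ (Unique.map⁺ ∷-injectiveʳ (climbings-unique (suc m) n))
             (settleds-unique m (suc n))
             (map-∷-disjoint λ 1+m∷ys∈ →
                1+n≰n (All.head (settled-bounded (proj₁ (to ∈-settleds⇔ 1+m∷ys∈)))))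

length-settleds : ∀ m n → length (settleds m n) ≡ 1 + m * n
length-settleds m zero    = cong suc (sym (*-zeroʳ m))
length-settleds m (suc n) = begin
  length (map (m ∷_) (settleds m n) ++ flats n m)      ≡⟨ length-++ (map (m ∷_) (settleds m n)) ⟩
  length (map (m ∷_) (settleds m n)) + length (flats n m)
    ≡⟨ cong₂ _+_ (trans (length-map _ (settleds m n)) (length-settleds m n))
                 (trans (length-map _ (upTo m)) (length-upTo m)) ⟩
  1 + m * n + m                                          ≡⟨ cong suc (trans (+-comm (m * n) m) (sym (*-suc m n))) ⟩
  1 + m * suc n                                          ∎
  where open ≡-Reasoning

length-climbings : ∀ m n → length (climbings m n) ≡ 1 + n + m * (suc n C 2) + suc n C 3
length-climbings m zero    = cong suc (sym (trans (+-identityʳ (m * 0)) (*-zeroʳ m)))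
length-climbings m (suc n) = begin
  length (map (suc m ∷_) (climbings (suc m) n) ++ settleds m (suc n))
    ≡⟨ length-++ (map (suc m ∷_) (climbings (suc m) n)) ⟩
  length (map (suc m ∷_) (climbings (suc m) n)) + length (settleds m (suc n))
    ≡⟨ cong₂ _+_ (trans (length-map _ (climbings (suc m) n)) (length-climbings (suc m) n))
                 (length-settleds m (suc n)) ⟩
  1 + n + suc m * X + Y + (1 + m * suc n)
    ≡⟨ regroup m n X Y ⟩
  1 + suc n + m * (suc n + X) + (X + Y)
    ≡⟨ sym (cong₂ (λ X′ Y′ → 1 + suc n + m * X′ + Y′) pascal₂ pascal₃) ⟩
  1 + suc n + m * (suc (suc n) C 2) + suc (suc n) C 3 ∎
  where
  open ≡-Reasoning
  X = suc n C 2
  Y = suc n C 3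

  pascal₂ : suc (suc n) C 2 ≡ suc n + X
  pascal₂ = trans (sym (nCk+nC[k+1]≡[n+1]C[k+1] (suc n) 1)) (cong (_+ X) (nC1≡n (suc n)))

  pascal₃ : suc (suc n) C 3 ≡ X + Y
  pascal₃ = sym (nCk+nC[k+1]≡[n+1]C[k+1] (suc n) 2)

  regroup : ∀ m n X Y → 1 + n + suc m * X + Y + (1 + m * suc n) ≡ 1 + suc n + m * (suc n + X) + (X + Y)
  regroup = solve-∀

inA⇔climbing : ∀ {n x xs} → InA (p001 ∷ p210 ∷ []) (suc n) (x ∷ xs) ⇔ (x ≡ 0 × Climbing 0 xs × length xs ≡ n)
inA⇔climbing = mk⇔ climbing avoider
  where
  climbing : ∀ {n x xs} → InA (p001 ∷ p210 ∷ []) (suc n) (x ∷ xs) → x ≡ 0 × Climbing 0 xs × length xs ≡ n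
  climbing (ascentSeq , len , avoids001 ∷ avoids210 ∷ []) with to isAscentSeq⇔ ascentSeq
  ... | refl , rest = refl , climbing-of rest (λ occ → no001 (0 ∷ʳ occ)) (λ occ → no210 (0 ∷ʳ occ))
                                           after001 (λ _ ()) , suc-injective len
    where
    no001 = to avoids001⇔ avoids001
    no210 = to avoids210⇔ avoids210

    after001 : No001After 0 _
    after001 occ z≤n = no001 (refl ∷ occ)

  avoider : ∀ {n x xs} → x ≡ 0 × Climbing 0 xs × length xs ≡ n → InA (p001 ∷ p210 ∷ []) (suc n) (x ∷ xs)
  avoider (refl , c , len) =
    from isAscentSeq⇔ (refl , climbing⇒ascentFrom c) , cong suc len ,
    from avoids001⇔ (proj₁ (climbing-avoids c)) ∷ from avoids210⇔ (proj₁ (proj₂ (climbing-avoids c))) ∷ []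

proposition2p13 : (n : ℕ) → 1 ≤ n →
    HasCount ((0 ∷ 0 ∷ 1 ∷ []) ∷ (2 ∷ 1 ∷ 0 ∷ []) ∷ []) n ((n C 3) + n)
proposition2p13 (suc n) _ =
  avoiders , Unique.map⁺ ∷-injectiveʳ (climbings-unique 0 n) , count , λ w → mk⇔ (inA w) (enumerated w)
  where
  avoiders = map (0 ∷_) (climbings 0 n)

  count : length avoiders ≡ suc n C 3 + suc n
  count = begin
    length avoiders               ≡⟨ trans (length-map _ (climbings 0 n)) (length-climbings 0 n) ⟩
    suc n + 0 + suc n C 3         ≡⟨ cong (_+ suc n C 3) (+-identityʳ (suc n)) ⟩
    suc n + suc n C 3             ≡⟨ +-comm (suc n) _ ⟩
    suc n C 3 + suc n             ∎
    where open ≡-Reasoning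

  inA : ∀ w → w ∈ avoiders → InA (p001 ∷ p210 ∷ []) (suc n) w
  inA w w∈ with ∈-map⁻ (0 ∷_) w∈
  ... | xs , xs∈ , refl = from inA⇔climbing (refl , to ∈-climbings⇔ xs∈)

  enumerated : ∀ w → InA (p001 ∷ p210 ∷ []) (suc n) w → w ∈ avoiders
  enumerated [] (_ , () , _)
  enumerated (x ∷ xs) w∈A with to inA⇔climbing w∈A
  ... | refl , c , len = ∈-map⁺ (0 ∷_) (from ∈-climbings⇔ (c , len))
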